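{- Let $0\le\ell<d<k$ be integers. Every $k$-graph $G$ on at least $d$ vertices with $\delta_d(G)>0$ is $\ell$-connected.
   Context: A $k$-graph has a vertex set and $k$-element edges; $\delta_d(G)$ is the largest $m$ such that every $d$-set of vertices lies in at least $m$ edges. The $\ell$-line graph of $G$ is the graph on $E(G)$ where $e,f$ are adjacent iff $|e\cap f|\ge\ell$. A subgraph is $\ell$-connected if it has no isolated vertices and its edges induce a connected subgraph of the $\ell$-line graph; $G$ is $\ell$-connected if $G$ itself is. -}

module Defs where

open import Data.Nat using (ℕ; zero; suc; _≤_; _⊓_)
open import Data.Nat.Properties using (_≟_)
open import Data.Fin using (Fin)
open import Data.Fin.Subset using (Subset; _⊆_; _∩_; ∣_∣; inside; outside; _∈_)
open import Data.Fin.Subset.Properties using (_⊆?_)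
open import Data.Vec using (_∷_; [])
open import Data.List using (List; []; _∷_; map; _++_; filter; length; foldr)
open import Data.List.Relation.Unary.All using (All)
open import Data.List.Relation.Unary.Unique.Propositional using (Unique)
import Data.List.Membership.Propositional as LM
open import Data.Product using (Σ; _×_; ∃-syntax)
open import Relation.Binary.Construct.Closure.ReflexiveTransitive using (Star)
open import Relation.Binary.PropositionalEquality using (_≡_)

record KGraph (n k : ℕ) : Set where
  field
    edges   : List (Subset n)
    unique  : Unique edges
    uniform : All (λ e → ∣ e ∣ ≡ k) edges
open KGraph public

allSubsets : (n : ℕ) → List (Subset n)
allSubsets zero    = [] ∷ []
allSubsets (suc n) = map (outside ∷_) (allSubsets n) ++ map (inside ∷_) (allSubsets n)

dSets : (n d : ℕ) → List (Subset n)
dSets n d = filter (λ S → ∣ S ∣ ≟ d) (allSubsets n)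

degree : ∀ {n k} → KGraph n k → Subset n → ℕ
degree G S = length (filter (S ⊆?_) (edges G))

minList : List ℕ → ℕ
minList []       = 0
minList (x ∷ xs) = foldr _⊓_ x xs

-- δ_d(G): minimum over all d-sets S of the number of edges containing S
-- (i.e. the largest m such that every d-set lies in at least m edges;
-- only used when n ≥ d so that there is at least one d-set).
δ : ∀ {n k} → ℕ → KGraph n k → ℕ
δ {n} d G = minList (map (degree G) (dSets n d))

LineAdj : ∀ {n k} → ℕ → KGraph n k → Subset n → Subset n → Set
LineAdj ℓ G e f = (e LM.∈ edges G) × (f LM.∈ edges G) × (ℓ ≤ ∣ e ∩ f ∣)

ℓConnected : ∀ {n k} → ℕ → KGraph n k → Set
ℓConnected {n} ℓ G =
  (∀ (v : Fin n) → ∃[ e ] (e LM.∈ edges G × v ∈ e))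
  × (∀ e f → e LM.∈ edges G → f LM.∈ edges G → Star (LineAdj ℓ G) e f)

{-# OPTIONS --safe #-}
module Submission where

-- Since δ_d(G) > 0 and n ≥ d, every set of at most d vertices lies in an
-- edge; in particular no vertex is isolated. Given edges g and f with
-- |g ∩ f| < ℓ, pick an ℓ-set A with g ∩ f ⊆ A ⊆ g and a vertex x ∈ f ∖ g.
-- As |{x} ∪ A| ≤ ℓ + 1 ≤ d, some edge h contains {x} ∪ A; then h is
-- ℓ-adjacent to g and h ∩ f strictly contains g ∩ f. Iterating, the
-- intersection with f grows until it has size ℓ, after at most k steps.

open import Defs
open import Data.Nat using (ℕ; _≤_; _<_; suc; _+_; _⊓_; z≤n; s≤s; _≤?_)
open import Data.Nat.Properties
open import Data.Bool using (Bool)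
open import Data.Fin using (Fin; zero; suc)
open import Data.Fin.Subset
  using (Subset; inside; outside; ⁅_⁆; _∪_; _∩_; _⊆_; _⊂_; _∈_; _∉_; ∣_∣)
open import Data.Fin.Subset.Properties
open import Data.Vec using ([]; _∷_; here; there)
open import Data.List using (List; []; _∷_; map; length; foldr)
open import Data.List.Relation.Unary.Any using (here; there)
open import Data.List.Relation.Unary.All as All using ()
open import Data.List.Membership.Propositional using () renaming (_∈_ to _∈ₗ_)
open import Data.List.Membership.Propositional.Properties
  using (∈-map⁺; ∈-filter⁺; ∈-filter⁻; ∈-++⁺ˡ; ∈-++⁺ʳ)
open import Data.Product using (_×_; _,_; proj₁; ∃-syntax)
open import Function using (_∘_)
open import Relation.Binary.Construct.Closure.ReflexiveTransitive using (Star; ε; _◅_)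
open import Relation.Binary.PropositionalEquality using (_≡_; refl; sym; cong; cong₂; subst)
open import Relation.Nullary using (yes; no; contradiction)

private
  variable
    ℓ k m n : ℕ
    s t : Bool
    p q r : Subset n

⊆-∩ : p ⊆ q → p ⊆ r → p ⊆ q ∩ r
⊆-∩ p⊆q p⊆r x∈p = x∈p∩q⁺ (p⊆q x∈p , p⊆r x∈p)

∣p∪q∣≤∣p∣+∣q∣ : ∀ (p q : Subset n) → ∣ p ∪ q ∣ ≤ ∣ p ∣ + ∣ q ∣
∣p∪q∣≤∣p∣+∣q∣ []            []            = z≤n
∣p∪q∣≤∣p∣+∣q∣ (inside  ∷ p) (t ∷ q)       =
  s≤s (≤-trans (∣p∪q∣≤∣p∣+∣q∣ p q) (+-monoʳ-≤ ∣ p ∣ (∣p∣≤∣x∷p∣ t q)))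
∣p∪q∣≤∣p∣+∣q∣ (outside ∷ p) (outside ∷ q) = ∣p∪q∣≤∣p∣+∣q∣ p q
∣p∪q∣≤∣p∣+∣q∣ (outside ∷ p) (inside  ∷ q) =
  ≤-trans (s≤s (∣p∪q∣≤∣p∣+∣q∣ p q)) (≤-reflexive (sym (+-suc ∣ p ∣ ∣ q ∣)))

sandwich : p ⊆ q → ∣ p ∣ ≤ m → m ≤ ∣ q ∣ → ∃[ r ] (p ⊆ r × r ⊆ q × ∣ r ∣ ≡ m)
sandwich {p = []} {[]} _ _ z≤n = [] , ⊆-refl , ⊆-refl , refl
sandwich {p = inside ∷ p} {outside ∷ q} p⊆q _ _ = contradiction (p⊆q here) λ ()
sandwich {p = inside ∷ p} {inside ∷ q} p⊆q (s≤s ∣p∣≤m) (s≤s m≤∣q∣) =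
  let r , p⊆r , r⊆q , ∣r∣≡m = sandwich (drop-∷-⊆ p⊆q) ∣p∣≤m m≤∣q∣
  in  inside ∷ r , s⊆s p⊆r , s⊆s r⊆q , cong suc ∣r∣≡m
sandwich {p = outside ∷ p} {outside ∷ q} p⊆q ∣p∣≤m m≤∣q∣ =
  let r , p⊆r , r⊆q , ∣r∣≡m = sandwich (drop-∷-⊆ p⊆q) ∣p∣≤m m≤∣q∣
  in  outside ∷ r , s⊆s p⊆r , s⊆s r⊆q , ∣r∣≡m
sandwich {p = outside ∷ p} {inside ∷ q} {m} p⊆q ∣p∣≤m m≤1+∣q∣ with m ≤? ∣ q ∣
... | yes m≤∣q∣ =
  let r , p⊆r , r⊆q , ∣r∣≡m = sandwich (drop-∷-⊆ p⊆q) ∣p∣≤m m≤∣q∣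
  in  outside ∷ r , s⊆s p⊆r , out⊆ r⊆q , ∣r∣≡m
... | no m≰∣q∣ = inside ∷ q , out⊆ (drop-∷-⊆ p⊆q) , ⊆-refl , ≤-antisym (≰⇒> m≰∣q∣) m≤1+∣q∣

there-∖ : ∃[ x ] (x ∈ p × x ∉ q) → ∃[ x ] (x ∈ s ∷ p × x ∉ t ∷ q)
there-∖ (x , x∈p , x∉q) = suc x , there x∈p , x∉q ∘ drop-there

∣q∩p∣<∣p∣⇒∃∈p∖q : ∣ q ∩ p ∣ < ∣ p ∣ → ∃[ x ] (x ∈ p × x ∉ q)
∣q∩p∣<∣p∣⇒∃∈p∖q {q = outside ∷ q} {p = inside  ∷ p} _  = zero , here , λ ()
∣q∩p∣<∣p∣⇒∃∈p∖q {q = inside  ∷ q} {p = inside  ∷ p} (s≤s lt) = there-∖ (∣q∩p∣<∣p∣⇒∃∈p∖q lt)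
∣q∩p∣<∣p∣⇒∃∈p∖q {q = outside ∷ q} {p = outside ∷ p} lt = there-∖ (∣q∩p∣<∣p∣⇒∃∈p∖q lt)
∣q∩p∣<∣p∣⇒∃∈p∖q {q = inside  ∷ q} {p = outside ∷ p} lt = there-∖ (∣q∩p∣<∣p∣⇒∃∈p∖q lt)

minList-≤ : ∀ {xs y} → y ∈ₗ xs → minList xs ≤ y
minList-≤ {x ∷ xs} = foldr-⊓-≤ x xs
  where
  foldr-⊓-≤ : ∀ x xs {y} → y ∈ₗ x ∷ xs → foldr _⊓_ x xs ≤ y
  foldr-⊓-≤ x []       (here refl)         = ≤-refl
  foldr-⊓-≤ x (z ∷ zs) (here refl)         = ≤-trans (m⊓n≤n z _) (foldr-⊓-≤ x zs (here refl))
  foldr-⊓-≤ x (z ∷ zs) (there (here refl)) = m⊓n≤m z _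
  foldr-⊓-≤ x (z ∷ zs) (there (there y∈)) = ≤-trans (m⊓n≤n z _) (foldr-⊓-≤ x zs (there y∈))

0<length⇒∃∈ : ∀ {A : Set} (xs : List A) → 0 < length xs → ∃[ x ] (x ∈ₗ xs)
0<length⇒∃∈ (x ∷ _) _ = x , here refl

∈-allSubsets : (p : Subset n) → p ∈ₗ allSubsets n
∈-allSubsets []            = here refl
∈-allSubsets (outside ∷ p) = ∈-++⁺ˡ (∈-map⁺ (outside ∷_) (∈-allSubsets p))
∈-allSubsets {suc n} (inside ∷ p) =
  ∈-++⁺ʳ (map (outside ∷_) (allSubsets n)) (∈-map⁺ (inside ∷_) (∈-allSubsets p))

δ≤degree : ∀ {d} (G : KGraph n k) {S} → ∣ S ∣ ≡ d → δ d G ≤ degree G S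
δ≤degree {d = d} G {S} ∣S∣≡d =
  minList-≤ (∈-map⁺ (degree G) (∈-filter⁺ (λ S → ∣ S ∣ ≟ d) (∈-allSubsets S) ∣S∣≡d))

0<degree⇒∃edge⊇ : (G : KGraph n k) {S : Subset n} →
                  0 < degree G S → ∃[ e ] (e ∈ₗ edges G × S ⊆ e)
0<degree⇒∃edge⊇ G {S} 0<deg =
  let e , e∈ = 0<length⇒∃∈ _ 0<deg in e , ∈-filter⁻ (S ⊆?_) {xs = edges G} e∈

Covers : ℕ → KGraph n k → Set
Covers {n} t G = ∀ (T : Subset n) → ∣ T ∣ ≤ t → ∃[ e ] (e ∈ₗ edges G × T ⊆ e)

0<δ⇒Covers : ∀ {d} (G : KGraph n k) → d ≤ n → 0 < δ d G → Covers d G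
0<δ⇒Covers {n} G d≤n 0<δ T ∣T∣≤d =
  let S , T⊆S , _ , ∣S∣≡d = sandwich (⊆⊤ {p = T}) ∣T∣≤d (subst (_ ≤_) (sym (∣⊤∣≡n n)) d≤n)
      e , e∈ , S⊆e       = 0<degree⇒∃edge⊇ G (<-≤-trans 0<δ (δ≤degree G ∣S∣≡d))
  in  e , e∈ , ⊆-trans T⊆S S⊆e

module _ (G : KGraph n k) (ℓ≤k : ℓ ≤ k) (covers : Covers (suc ℓ) G) where

  private
    ℓ≤∣e∣ : ∀ {e} → e ∈ₗ edges G → ℓ ≤ ∣ e ∣
    ℓ≤∣e∣ e∈ = subst (ℓ ≤_) (sym (All.lookup (uniform G) e∈)) ℓ≤k

  ∃closer-edge : ∀ {g f} → g ∈ₗ edges G → f ∈ₗ edges G → ∣ g ∩ f ∣ < ℓ →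
                 ∃[ h ] (h ∈ₗ edges G × ℓ ≤ ∣ g ∩ h ∣ × g ∩ f ⊂ h ∩ f)
  ∃closer-edge {g} {f} g∈ f∈ ∣g∩f∣<ℓ
    with sandwich (p∩q⊆p g f) (<⇒≤ ∣g∩f∣<ℓ) (ℓ≤∣e∣ g∈)
       | ∣q∩p∣<∣p∣⇒∃∈p∖q (<-≤-trans ∣g∩f∣<ℓ (ℓ≤∣e∣ f∈))
  ... | A , g∩f⊆A , A⊆g , ∣A∣≡ℓ | x , x∈f , x∉g
    with covers (⁅ x ⁆ ∪ A)
                (≤-trans (∣p∪q∣≤∣p∣+∣q∣ ⁅ x ⁆ A) (≤-reflexive (cong₂ _+_ (∣⁅x⁆∣≡1 x) ∣A∣≡ℓ)))
  ... | h , h∈ , x∪A⊆h = h , h∈ , ℓ≤∣g∩h∣ , g∩f⊂h∩f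
    where
    A⊆h : A ⊆ h
    A⊆h = ⊆-trans (q⊆p∪q ⁅ x ⁆ A) x∪A⊆h

    ℓ≤∣g∩h∣ : ℓ ≤ ∣ g ∩ h ∣
    ℓ≤∣g∩h∣ = subst (_≤ ∣ g ∩ h ∣) ∣A∣≡ℓ (p⊆q⇒∣p∣≤∣q∣ (⊆-∩ A⊆g A⊆h))

    g∩f⊂h∩f : g ∩ f ⊂ h ∩ f
    g∩f⊂h∩f = ⊆-∩ (⊆-trans g∩f⊆A A⊆h) (p∩q⊆q g f)
            , x , x∈p∩q⁺ (x∪A⊆h (p⊆p∪q A (x∈⁅x⁆ x)) , x∈f)
            , x∉g ∘ proj₁ ∘ x∈p∩q⁻ g f

  walk : ∀ N {g f} → g ∈ₗ edges G → f ∈ₗ edges G → k ≤ N + ∣ g ∩ f ∣ →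
         Star (LineAdj ℓ G) g f
  walk N {g} {f} g∈ f∈ k≤N+∣g∩f∣ with ℓ ≤? ∣ g ∩ f ∣
  ... | yes ℓ≤∣g∩f∣ = (g∈ , f∈ , ℓ≤∣g∩f∣) ◅ ε
  walk 0 g∈ f∈ k≤∣g∩f∣ | no ℓ≰∣g∩f∣ = contradiction (≤-trans ℓ≤k k≤∣g∩f∣) ℓ≰∣g∩f∣
  walk (suc N) {g} {f} g∈ f∈ k≤1+N+∣g∩f∣ | no ℓ≰∣g∩f∣
    with ∃closer-edge g∈ f∈ (≰⇒> ℓ≰∣g∩f∣)
  ... | h , h∈ , ℓ≤∣g∩h∣ , g∩f⊂h∩f = (g∈ , h∈ , ℓ≤∣g∩h∣) ◅ walk N h∈ f∈ k≤N+∣h∩f∣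
    where
    open ≤-Reasoning
    k≤N+∣h∩f∣ : k ≤ N + ∣ h ∩ f ∣
    k≤N+∣h∩f∣ = begin
      k                   ≤⟨ k≤1+N+∣g∩f∣ ⟩
      suc (N + ∣ g ∩ f ∣) ≡⟨ sym (+-suc N _) ⟩
      N + suc ∣ g ∩ f ∣   ≤⟨ +-monoʳ-≤ N (p⊂q⇒∣p∣<∣q∣ g∩f⊂h∩f) ⟩
      N + ∣ h ∩ f ∣       ∎

  Covers⇒ℓConnected : ℓConnected ℓ G
  Covers⇒ℓConnected = noIsolated , λ e f e∈ f∈ → walk k e∈ f∈ (m≤m+n k _)
    where
    noIsolated : ∀ (v : Fin n) → ∃[ e ] (e ∈ₗ edges G × v ∈ e)
    noIsolated v =
      let e , e∈ , v⊆e = covers ⁅ v ⁆ (subst (_≤ suc ℓ) (sym (∣⁅x⁆∣≡1 v)) (s≤s z≤n))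
      in  e , e∈ , v⊆e (x∈⁅x⁆ v)

lemma3p1 : (ℓ d k n : ℕ) → ℓ < d → d < k → (G : KGraph n k) →
    d ≤ n → 0 < δ d G → ℓConnected ℓ G
lemma3p1 ℓ d k n ℓ<d d<k G d≤n 0<δ =
  Covers⇒ℓConnected G (<⇒≤ (<-trans ℓ<d d<k))
    (λ T ∣T∣≤1+ℓ → 0<δ⇒Covers G d≤n 0<δ T (≤-trans ∣T∣≤1+ℓ ℓ<d))
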